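{- Fix an integer $b>4$ and an integer $k$. Let $T$ be a $(b,k)$-overslack tree of height $h$. Then for every $0\le\delta\le h$, the total degree of the nodes at depth $\delta$ in $T$ equals $d(\delta,k)$, where $d(0,k)=k$, $d(1,k)=kb-b$, and $d(\delta,k)=b\,(d(\delta-1,k)-d(\delta-2,k))$ for $\delta\ge 2$.
   Context: Leaf-oriented search trees store keys in leaves; the degree of an internal node is its number of non-nil child pointers and the degree of a leaf is its number of keys; a node of degree $b-x$ contains $x$ units of slack. Height is the depth of the leaves (root at depth 0). A $(b,k)$-overslack tree is a leaf-oriented search tree whose root has degree $k$, in which all leaves have the same depth, every internal node has between $2$ and $b$ child pointers, every leaf has between $0$ and $b$ keys, and for every internal node $u$ the children of $u$ contain a total of exactly $b$ slack. -}

module Defs where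

open import Data.Nat using (ℕ; zero; suc; _+_; _∸_; _≤_)
open import Data.Integer as ℤ using (ℤ; +_)
open import Data.List using (List; []; _∷_; length)
open import Data.List.Relation.Unary.All using (All)
open import Data.Product using (_×_)
open import Relation.Binary.PropositionalEquality using (_≡_)

-- Leaf-oriented tree over a key type K. Leaves store a list of keys;
-- internal nodes store the list of their non-nil child pointers.
data Tree (K : Set) : Set where
  leaf : List K → Tree K
  node : List (Tree K) → Tree K

module _ {K : Set} where

  deg : Tree K → ℕ
  deg (leaf ks) = length ks
  deg (node ts) = length ts

  slackSum : ℕ → List (Tree K) → ℕ
  slackSum b [] = 0
  slackSum b (t ∷ ts) = (b ∸ deg t) + slackSum b ts

  data HasHeight : ℕ → Tree K → Set where
    leafH : ∀ {ks} → HasHeight 0 (leaf ks)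
    nodeH : ∀ {h ts} → All (HasHeight h) ts → HasHeight (suc h) (node ts)

  data OverslackNodes (b : ℕ) : Tree K → Set where
    leafO : ∀ {ks} → length ks ≤ b → OverslackNodes b (leaf ks)
    nodeO : ∀ {ts} → 2 ≤ length ts → length ts ≤ b →
            All (OverslackNodes b) ts → slackSum b ts ≡ b →
            OverslackNodes b (node ts)

  IsOverslack : ℕ → ℕ → ℕ → Tree K → Set
  IsOverslack b k h t = (deg t ≡ k) × HasHeight h t × OverslackNodes b t

  levelDeg : ℕ → Tree K → ℕ
  levelDegs : ℕ → List (Tree K) → ℕ
  levelDeg zero t = deg t
  levelDeg (suc δ) (leaf _) = 0
  levelDeg (suc δ) (node ts) = levelDegs δ ts
  levelDegs δ [] = 0
  levelDegs δ (t ∷ ts) = levelDeg δ t + levelDegs δ ts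

d : ℕ → ℕ → ℕ → ℤ
d b k zero = + k
d b k (suc zero) = (+ k ℤ.* + b) ℤ.- + b
d b k (suc (suc n)) = + b ℤ.* (d b k (suc n) ℤ.- d b k n)

-- Let N(δ) and D(δ) be the number and the total degree of the nodes at depth δ.
-- Above the leaves every node is internal, so N(δ+1) = D(δ). The children of an
-- internal node u have b·deg(u) − b total degree, because their slack sums to b;
-- summing over depth δ gives D(δ+1) = b·D(δ) − b·N(δ). With N(0) = 1 and
-- N(δ) = D(δ−1) this is exactly the recurrence defining d.
module Submission where

open import Defs
open import Data.Nat using (ℕ; zero; suc; _+_; _*_; _∸_; _<_; _≤_; s≤s)
open import Data.Nat.Properties
  using (m∸n+n≡m; *-suc; *-zeroʳ; *-identityʳ; *-distribˡ-+; +-comm; ≤-trans; n≤1+n;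
         +-commutativeSemigroup)
open import Algebra.Properties.CommutativeSemigroup +-commutativeSemigroup using (interchange)
open import Data.Integer as ℤ using (ℤ; +_)
open import Data.Integer.Properties using (pos-+; pos-*)
open import Data.Integer.Tactic.RingSolver using (solve-∀)
open import Data.List using (List; []; _∷_; length)
open import Data.List.Relation.Unary.All as All using (All; []; _∷_)
open import Data.Product using (_,_)
open import Relation.Binary.PropositionalEquality using (_≡_; refl; sym; trans; cong; cong₂; module ≡-Reasoning)

module _ {K : Set} where

  levelCount : ℕ → Tree K → ℕ
  levelCounts : ℕ → List (Tree K) → ℕ
  levelCount zero t = 1
  levelCount (suc δ) (leaf _) = 0
  levelCount (suc δ) (node ts) = levelCounts δ ts
  levelCounts δ [] = 0
  levelCounts δ (t ∷ ts) = levelCount δ t + levelCounts δ ts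

  levelCounts-zero : (ts : List (Tree K)) → levelCounts 0 ts ≡ length ts
  levelCounts-zero [] = refl
  levelCounts-zero (t ∷ ts) = cong suc (levelCounts-zero ts)

  levelCount-suc : ∀ δ {h} {t : Tree K} → HasHeight h t → suc δ ≤ h →
                   levelCount (suc δ) t ≡ levelDeg δ t
  levelCounts-suc : ∀ δ {h} {ts : List (Tree K)} → All (HasHeight h) ts → suc δ ≤ h →
                    levelCounts (suc δ) ts ≡ levelDegs δ ts
  levelCount-suc δ leafH ()
  levelCount-suc zero {t = node ts} _ _ = levelCounts-zero ts
  levelCount-suc (suc δ) (nodeH hs) (s≤s δ<h) = levelCounts-suc δ hs δ<h
  levelCounts-suc δ [] _ = refl
  levelCounts-suc δ (ht ∷ hs) δ<h = cong₂ _+_ (levelCount-suc δ ht δ<h) (levelCounts-suc δ hs δ<h)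

  module _ (b : ℕ) where

    deg≤ : {t : Tree K} → OverslackNodes b t → deg t ≤ b
    deg≤ (leafO ks≤b) = ks≤b
    deg≤ (nodeO _ ts≤b _ _) = ts≤b

    slackSum+levelDegs : {ts : List (Tree K)} → All (λ t → deg t ≤ b) ts →
                         slackSum b ts + levelDegs 0 ts ≡ b * length ts
    slackSum+levelDegs [] = sym (*-zeroʳ b)
    slackSum+levelDegs {t ∷ ts} (t≤b ∷ ts≤b) = begin
      (b ∸ deg t + slackSum b ts) + (deg t + levelDegs 0 ts)
        ≡⟨ interchange (b ∸ deg t) (slackSum b ts) (deg t) (levelDegs 0 ts) ⟩
      (b ∸ deg t + deg t) + (slackSum b ts + levelDegs 0 ts)
        ≡⟨ cong₂ _+_ (m∸n+n≡m t≤b) (slackSum+levelDegs ts≤b) ⟩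
      b + b * length ts
        ≡⟨ sym (*-suc b (length ts)) ⟩
      b * suc (length ts) ∎
      where open ≡-Reasoning

    childDegrees : {ts : List (Tree K)} → OverslackNodes b (node ts) →
                   levelDegs 0 ts + b ≡ b * length ts
    childDegrees {ts} (nodeO _ _ os slack≡b) = begin
      levelDegs 0 ts + b             ≡⟨ +-comm (levelDegs 0 ts) b ⟩
      b + levelDegs 0 ts             ≡⟨ cong (_+ levelDegs 0 ts) (sym slack≡b) ⟩
      slackSum b ts + levelDegs 0 ts ≡⟨ slackSum+levelDegs (All.map deg≤ os) ⟩
      b * length ts                  ∎
      where open ≡-Reasoning

    levelDeg-suc : ∀ δ {h} {t : Tree K} → HasHeight h t → OverslackNodes b t → suc δ ≤ h →
                   levelDeg (suc δ) t + b * levelCount δ t ≡ b * levelDeg δ t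
    levelDegs-suc : ∀ δ {h} {ts : List (Tree K)} → All (HasHeight h) ts →
                    All (OverslackNodes b) ts → suc δ ≤ h →
                    levelDegs (suc δ) ts + b * levelCounts δ ts ≡ b * levelDegs δ ts
    levelDeg-suc δ leafH _ ()
    levelDeg-suc zero {t = node ts} _ o _ =
      trans (cong (λ n → levelDegs 0 ts + n) (*-identityʳ b)) (childDegrees o)
    levelDeg-suc (suc δ) (nodeH hs) (nodeO _ _ os _) (s≤s δ<h) = levelDegs-suc δ hs os δ<h
    levelDegs-suc δ [] [] _ = trans (*-zeroʳ b) (sym (*-zeroʳ b))
    levelDegs-suc δ {ts = t ∷ ts} (ht ∷ hs) (o ∷ os) δ<h = begin
      (levelDeg (suc δ) t + levelDegs (suc δ) ts) + b * (levelCount δ t + levelCounts δ ts)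
        ≡⟨ cong (λ n → levelDeg (suc δ) t + levelDegs (suc δ) ts + n) (*-distribˡ-+ b _ _) ⟩
      (levelDeg (suc δ) t + levelDegs (suc δ) ts) + (b * levelCount δ t + b * levelCounts δ ts)
        ≡⟨ interchange (levelDeg (suc δ) t) _ _ _ ⟩
      (levelDeg (suc δ) t + b * levelCount δ t) + (levelDegs (suc δ) ts + b * levelCounts δ ts)
        ≡⟨ cong₂ _+_ (levelDeg-suc δ ht o δ<h) (levelDegs-suc δ hs os δ<h) ⟩
      b * levelDeg δ t + b * levelDegs δ ts
        ≡⟨ sym (*-distribˡ-+ b (levelDeg δ t) (levelDegs δ ts)) ⟩
      b * (levelDeg δ t + levelDegs δ ts) ∎
      where open ≡-Reasoning

x+b*y≡b*z⇒x≡b*[z-y] : ∀ x b y z → x + b * y ≡ b * z → + x ≡ + b ℤ.* (+ z ℤ.- + y)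
x+b*y≡b*z⇒x≡b*[z-y] x b y z eq = begin
  + x                                       ≡⟨ cancel (+ x) (+ b ℤ.* + y) ⟩
  (+ x ℤ.+ + b ℤ.* + y) ℤ.- + b ℤ.* + y    ≡⟨ cong (ℤ._- + b ℤ.* + y) lhs≡rhs ⟩
  + b ℤ.* + z ℤ.- + b ℤ.* + y              ≡⟨ factor (+ b) (+ z) (+ y) ⟩
  + b ℤ.* (+ z ℤ.- + y)                    ∎
  where
  open ≡-Reasoning
  cancel : ∀ (X Y : ℤ) → X ≡ (X ℤ.+ Y) ℤ.- Y
  cancel = solve-∀
  factor : ∀ (B Z Y : ℤ) → B ℤ.* Z ℤ.- B ℤ.* Y ≡ B ℤ.* (Z ℤ.- Y)
  factor = solve-∀
  lhs≡rhs : + x ℤ.+ + b ℤ.* + y ≡ + b ℤ.* + z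
  lhs≡rhs = begin
    + x ℤ.+ + b ℤ.* + y  ≡⟨ cong (λ n → + x ℤ.+ n) (sym (pos-* b y)) ⟩
    + x ℤ.+ + (b * y)    ≡⟨ sym (pos-+ x (b * y)) ⟩
    + (x + b * y)        ≡⟨ cong +_ eq ⟩
    + (b * z)            ≡⟨ pos-* b z ⟩
    + b ℤ.* + z          ∎

lemma2 : (b : ℕ) → 4 < b → (k h : ℕ) → {K : Set} → (T : Tree K) →
           IsOverslack b k h T →
           (δ : ℕ) → δ ≤ h → + (levelDeg δ T) ≡ d b k δ
lemma2 b _ k h T (deg≡k , hT , oT) = level
  where
  open ≡-Reasoning
  recurrence : ∀ δ → suc δ ≤ h → + levelDeg (suc δ) T ≡ + b ℤ.* (+ levelDeg δ T ℤ.- + levelCount δ T)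
  recurrence δ δ<h = x+b*y≡b*z⇒x≡b*[z-y] _ b _ _ (levelDeg-suc b δ hT oT δ<h)

  level : (δ : ℕ) → δ ≤ h → + (levelDeg δ T) ≡ d b k δ
  level zero _ = cong +_ deg≡k
  level (suc zero) 1≤h = begin
    + levelDeg 1 T              ≡⟨ recurrence 0 1≤h ⟩
    + b ℤ.* (+ deg T ℤ.- + 1)  ≡⟨ cong (λ n → + b ℤ.* (+ n ℤ.- + 1)) deg≡k ⟩
    + b ℤ.* (+ k ℤ.- + 1)      ≡⟨ expand (+ b) (+ k) ⟩
    + k ℤ.* + b ℤ.- + b        ∎
    where
    expand : ∀ (B W : ℤ) → B ℤ.* (W ℤ.- ℤ.1ℤ) ≡ W ℤ.* B ℤ.- B
    expand = solve-∀
  level (suc (suc δ)) δ+2≤h = begin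
    + levelDeg (suc (suc δ)) T
      ≡⟨ recurrence (suc δ) δ+2≤h ⟩
    + b ℤ.* (+ levelDeg (suc δ) T ℤ.- + levelCount (suc δ) T)
      ≡⟨ cong (λ n → + b ℤ.* (+ levelDeg (suc δ) T ℤ.- + n)) (levelCount-suc δ hT δ+1≤h) ⟩
    + b ℤ.* (+ levelDeg (suc δ) T ℤ.- + levelDeg δ T)
      ≡⟨ cong₂ (λ u v → + b ℤ.* (u ℤ.- v)) (level (suc δ) δ+1≤h) (level δ (≤-trans (n≤1+n δ) δ+1≤h)) ⟩
    + b ℤ.* (d b k (suc δ) ℤ.- d b k δ) ∎
    where
    δ+1≤h : suc δ ≤ h
    δ+1≤h = ≤-trans (n≤1+n (suc δ)) δ+2≤h
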